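{- Let $\alpha=\frac{1+\sqrt5}{2}$. For integers $n\ge0$ and $j\ge1$, \[ \sum_{k=0}^n\binom{n}{k}2^kF_{jk}(\sqrt5F_j)^{n-k}B_{n-k}(\alpha)=nF_j2^{1-n}\Big((\sqrt5F_j+L_{j+3})^{n-1}+(-\sqrt5F_j+L_{j+3})^{n-1}\Big). \] Moreover, for integers $n\ge0$ and $j\ge3$, \[ \sum_{k=0}^n\binom{n}{k}2^kF_{jk}(-\sqrt5F_j)^{n-k}B_{n-k}(\alpha)=nF_j2^{1-n}\Big((\sqrt5F_j-L_{j-3})^{n-1}+(-\sqrt5F_j-L_{j-3})^{n-1}\Big). \]
   Context: $F_n$ and $L_n$ denote the Fibonacci and Lucas numbers: $F_0=0,F_1=1$, $L_0=2,L_1=1$, and $u_n=u_{n-1}+u_{n-2}$. The Bernoulli polynomials $B_n(x)$ are defined by $\sum_{n\ge0}B_n(x)\frac{z^n}{n!}=\frac{ze^{xz}}{e^z-1}$. For $n=0$ the right-hand sides are $0$. -}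

module Defs where

open import Data.Nat as ℕ using (ℕ; zero; suc; _∸_; _≡ᵇ_)
open import Data.Nat.Combinatorics using (_C_)
open import Data.Integer using (+_)
open import Data.Rational as ℚ using (ℚ; 0ℚ; 1ℚ; ½)
open import Data.Bool using (if_then_else_)

fib : ℕ → ℕ
fib 0 = 0
fib 1 = 1
fib (suc (suc n)) = fib (suc n) ℕ.+ fib n

lucas : ℕ → ℕ
lucas 0 = 2
lucas 1 = 1
lucas (suc (suc n)) = lucas (suc n) ℕ.+ lucas n

ℕtoℚ : ℕ → ℚ
ℕtoℚ n = (+ n) ℚ./ 1

ΣQ : ℕ → (ℕ → ℚ) → ℚ
ΣQ zero f = 0ℚ
ΣQ (suc n) f = ΣQ n f ℚ.+ f n

-- Bernoulli numbers B_n (convention B_1 = -1/2, i.e. z/(e^z-1)),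
-- via the recurrence  sum_{k=0}^{n} C(n+1,k) B_k = 0  (n ≥ 1), B_0 = 1.
-- bernTable m k = B_k for all k ≤ m.

bernTable : ℕ → ℕ → ℚ
bernTable zero = λ _ → 1ℚ
bernTable (suc m) k =
  if k ≡ᵇ suc m
  then ℚ.- ((+ 1 ℚ./ suc (suc m)) ℚ.*
            ΣQ (suc m) (λ i → ℕtoℚ (suc (suc m) C i) ℚ.* bernTable m i))
  else bernTable m k

bernoulliNum : ℕ → ℚ
bernoulliNum n = bernTable n n

-- The field ℚ(√5): a + b√5 represented as a pair of rationals.

record Q5 : Set where
  constructor q5
  field
    re : ℚ
    im : ℚ
open Q5 public

infixl 6 _⊕_
infixl 7 _⊗_

_⊕_ : Q5 → Q5 → Q5
q5 a b ⊕ q5 c d = q5 (a ℚ.+ c) (b ℚ.+ d)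

_⊗_ : Q5 → Q5 → Q5
q5 a b ⊗ q5 c d = q5 (a ℚ.* c ℚ.+ ℕtoℚ 5 ℚ.* b ℚ.* d) (a ℚ.* d ℚ.+ b ℚ.* c)

⊖_ : Q5 → Q5
⊖ q5 a b = q5 (ℚ.- a) (ℚ.- b)

fromℚ : ℚ → Q5
fromℚ q = q5 q 0ℚ

fromℕ : ℕ → Q5
fromℕ n = fromℚ (ℕtoℚ n)

0Q5 : Q5
0Q5 = fromℚ 0ℚ

1Q5 : Q5
1Q5 = fromℚ 1ℚ

√5 : Q5
√5 = q5 0ℚ 1ℚ

α : Q5
α = q5 ½ ½

powQ : ℚ → ℕ → ℚ
powQ q zero = 1ℚ
powQ q (suc n) = q ℚ.* powQ q n

infixr 8 _^_
_^_ : Q5 → ℕ → Q5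
x ^ zero = 1Q5
x ^ suc n = x ⊗ (x ^ n)

Σ5 : ℕ → (ℕ → Q5) → Q5
Σ5 zero f = 0Q5
Σ5 (suc n) f = Σ5 n f ⊕ f n

bernoulliPoly : ℕ → Q5 → Q5
bernoulliPoly n x =
  Σ5 (suc n) (λ k → fromℚ (ℕtoℚ (n C k) ℚ.* bernoulliNum k) ⊗ x ^ (n ∸ k))

-- The two sides of Corollary 19.
-- s = ±√5 F_j  (passed as a Q5 value)

lhs : ℕ → ℕ → Q5 → Q5
lhs n j s =
  Σ5 (suc n) (λ k →
    fromℕ ((n C k) ℕ.* (2 ℕ.^ k) ℕ.* fib (j ℕ.* k))
      ⊗ (s ^ (n ∸ k)) ⊗ bernoulliPoly (n ∸ k) α)

-- n F_j 2^{1-n} ( (s + c)^{n-1} + (-s + c)^{n-1} ), defined as 0 for n = 0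
rhs : ℕ → ℕ → Q5 → Q5 → Q5
rhs zero j s c = 0Q5
rhs (suc m) j s c =
  fromℚ (ℕtoℚ (suc m ℕ.* fib j) ℚ.* powQ ½ m)
    ⊗ ((s ⊕ c) ^ m ⊕ ((⊖ s) ⊕ c) ^ m)

{-# OPTIONS --safe #-}
module Submission where

-- Write s = ±√5 F_j and H_n(s, z) = Σ_i C(n,i) B_i s^i z^(n-i) = s^n B_n(z/s).
-- Binet's formula √5 F_jk = α^jk - β^jk splits √5 times the left-hand side into
-- Σ_k C(n,k) (2α^j)^k s^(n-k) B_(n-k)(α) minus the same sum with β, and by the
-- Appell property these are H_n(s, 2α^j + sα) and H_n(s, 2β^j + sα). The two
-- arguments differ by 2√5 F_j = ±2s, so the difference equation
-- B_n(x+1) - B_n(x) = n x^(n-1), applied twice, leaves n s (z₁^(n-1) + z₂^(n-1)),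
-- where 2z₁ and 2z₂ are the numbers ±√5 F_j + c of the right-hand side; c comes
-- out of 2α^j = L_j + √5 F_j together with L_(j+3) = 5F_j + 2L_j and
-- L_(j-3) = 5F_j - 2L_j.

open import Defs
open import Data.Nat using (ℕ; zero; suc; _≥_; _∸_; _+_; _*_; _≤_; _<_; z≤n; s≤s; _!; _≡ᵇ_)
import Data.Nat as ℕ
import Data.Nat.Properties as ℕ
open import Data.Nat.Combinatorics using (_C_; nCk≡n!/k![n-k]!; k![n∸k]!∣n!; nCk≡nC[n∸k]; nC1≡n; nCn≡1)
open import Data.Nat.DivMod using (m/n*n≡m)
open import Data.Nat.Divisibility using (∣1⇒≡1)
open import Data.Nat.Tactic.RingSolver using () renaming (solve-∀ to ℕ-solve)
open import Data.Integer as ℤ using (+_)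
import Data.Integer.Properties as ℤ
open import Data.Rational as ℚ using (ℚ; 0ℚ; 1ℚ; ½; mkℚ)
import Data.Rational.Properties as ℚ
import Data.Rational.Unnormalised as ℚᵘ
import Data.Rational.Unnormalised.Properties as ℚᵘ
open import Data.Fin using (toℕ)
open import Data.Vec.Functional using (foldr)
open import Data.Bool using (true; false; T)
open import Data.Unit using (tt)
open import Data.Empty using (⊥-elim)
open import Data.Sum using (inj₁; inj₂)
open import Data.Maybe using (Maybe; just; nothing)
open import Data.Product using (_×_; _,_; proj₁; proj₂)
open import Function using (flip)
open import Level using (0ℓ)
open import Relation.Nullary using (yes)
open import Relation.Binary.PropositionalEquality
open import Algebra.Bundles using (CommutativeRing; CommutativeSemiring)
open import Algebra.Structures {A = Q5} _≡_ using (IsCommutativeRing)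
import Algebra.Properties.CommutativeSemiring.Binomial as Binomial
import Algebra.Definitions.RawSemiring as RawSemiring
import Tactic.RingSolver.Core.AlmostCommutativeRing as ACR
open import Tactic.RingSolver using (solve-∀)
open ≡-Reasoning

-- Arithmetic in ℚ(√5)

ℚ-ring : ACR.AlmostCommutativeRing 0ℓ 0ℓ
ℚ-ring = ACR.fromCommutativeRing ℚ.+-*-commutativeRing (λ _ → nothing)

⊕-comm : ∀ x y → x ⊕ y ≡ y ⊕ x
⊕-comm (q5 a b) (q5 c d) = cong₂ q5 (ℚ.+-comm a c) (ℚ.+-comm b d)

⊕-assoc : ∀ x y z → (x ⊕ y) ⊕ z ≡ x ⊕ (y ⊕ z)
⊕-assoc (q5 a b) (q5 c d) (q5 e f) = cong₂ q5 (ℚ.+-assoc a c e) (ℚ.+-assoc b d f)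

⊕-identityˡ : ∀ x → 0Q5 ⊕ x ≡ x
⊕-identityˡ (q5 a b) = cong₂ q5 (ℚ.+-identityˡ a) (ℚ.+-identityˡ b)

⊕-identityʳ : ∀ x → x ⊕ 0Q5 ≡ x
⊕-identityʳ (q5 a b) = cong₂ q5 (ℚ.+-identityʳ a) (ℚ.+-identityʳ b)

⊖-inverseˡ : ∀ x → ⊖ x ⊕ x ≡ 0Q5
⊖-inverseˡ (q5 a b) = cong₂ q5 (ℚ.+-inverseˡ a) (ℚ.+-inverseˡ b)

⊖-inverseʳ : ∀ x → x ⊕ ⊖ x ≡ 0Q5
⊖-inverseʳ (q5 a b) = cong₂ q5 (ℚ.+-inverseʳ a) (ℚ.+-inverseʳ b)

⊗-comm : ∀ x y → x ⊗ y ≡ y ⊗ x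
⊗-comm (q5 a b) (q5 c d) = cong₂ q5 (rational-part (ℕtoℚ 5) a b c d) (√5-part a b c d)
  where
  rational-part : ∀ k a b c d → a ℚ.* c ℚ.+ k ℚ.* b ℚ.* d ≡ c ℚ.* a ℚ.+ k ℚ.* d ℚ.* b
  rational-part = solve-∀ ℚ-ring
  √5-part : ∀ a b c d → a ℚ.* d ℚ.+ b ℚ.* c ≡ c ℚ.* b ℚ.+ d ℚ.* a
  √5-part = solve-∀ ℚ-ring

⊗-assoc : ∀ x y z → (x ⊗ y) ⊗ z ≡ x ⊗ (y ⊗ z)
⊗-assoc (q5 a b) (q5 c d) (q5 e f) =
  cong₂ q5 (rational-part (ℕtoℚ 5) a b c d e f) (√5-part (ℕtoℚ 5) a b c d e f)
  where
  rational-part : ∀ k a b c d e f →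
    (a ℚ.* c ℚ.+ k ℚ.* b ℚ.* d) ℚ.* e ℚ.+ k ℚ.* (a ℚ.* d ℚ.+ b ℚ.* c) ℚ.* f
      ≡ a ℚ.* (c ℚ.* e ℚ.+ k ℚ.* d ℚ.* f) ℚ.+ k ℚ.* b ℚ.* (c ℚ.* f ℚ.+ d ℚ.* e)
  rational-part = solve-∀ ℚ-ring
  √5-part : ∀ k a b c d e f →
    (a ℚ.* c ℚ.+ k ℚ.* b ℚ.* d) ℚ.* f ℚ.+ (a ℚ.* d ℚ.+ b ℚ.* c) ℚ.* e
      ≡ a ℚ.* (c ℚ.* f ℚ.+ d ℚ.* e) ℚ.+ b ℚ.* (c ℚ.* e ℚ.+ k ℚ.* d ℚ.* f)
  √5-part = solve-∀ ℚ-ring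

⊗-identityˡ : ∀ x → 1Q5 ⊗ x ≡ x
⊗-identityˡ (q5 a b) = cong₂ q5
  (trans (cong₂ ℚ._+_ (ℚ.*-identityˡ a) (trans (cong (ℚ._* b) (ℚ.*-zeroʳ (ℕtoℚ 5))) (ℚ.*-zeroˡ b)))
         (ℚ.+-identityʳ a))
  (trans (cong₂ ℚ._+_ (ℚ.*-identityˡ b) (ℚ.*-zeroˡ a)) (ℚ.+-identityʳ b))

⊗-identityʳ : ∀ x → x ⊗ 1Q5 ≡ x
⊗-identityʳ x = trans (⊗-comm x 1Q5) (⊗-identityˡ x)

⊗-distribˡ-⊕ : ∀ x y z → x ⊗ (y ⊕ z) ≡ x ⊗ y ⊕ x ⊗ z
⊗-distribˡ-⊕ (q5 a b) (q5 c d) (q5 e f) =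
  cong₂ q5 (rational-part (ℕtoℚ 5) a b c d e f) (√5-part a b c d e f)
  where
  rational-part : ∀ k a b c d e f →
    a ℚ.* (c ℚ.+ e) ℚ.+ k ℚ.* b ℚ.* (d ℚ.+ f)
      ≡ (a ℚ.* c ℚ.+ k ℚ.* b ℚ.* d) ℚ.+ (a ℚ.* e ℚ.+ k ℚ.* b ℚ.* f)
  rational-part = solve-∀ ℚ-ring
  √5-part : ∀ a b c d e f →
    a ℚ.* (d ℚ.+ f) ℚ.+ b ℚ.* (c ℚ.+ e) ≡ (a ℚ.* d ℚ.+ b ℚ.* c) ℚ.+ (a ℚ.* f ℚ.+ b ℚ.* e)
  √5-part = solve-∀ ℚ-ring

⊗-distribʳ-⊕ : ∀ x y z → (y ⊕ z) ⊗ x ≡ y ⊗ x ⊕ z ⊗ x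
⊗-distribʳ-⊕ x y z =
  trans (⊗-comm (y ⊕ z) x) (trans (⊗-distribˡ-⊕ x y z) (cong₂ _⊕_ (⊗-comm x y) (⊗-comm x z)))

⊕-⊗-isCommutativeRing : IsCommutativeRing _⊕_ _⊗_ ⊖_ 0Q5 1Q5
⊕-⊗-isCommutativeRing = record
  { isRing = record
    { +-isAbelianGroup = record
      { isGroup = record
        { isMonoid = record
          { isSemigroup = record
            { isMagma = record { isEquivalence = isEquivalence ; ∙-cong = cong₂ _⊕_ }
            ; assoc = ⊕-assoc }
          ; identity = ⊕-identityˡ , ⊕-identityʳ }
        ; inverse = ⊖-inverseˡ , ⊖-inverseʳ
        ; ⁻¹-cong = cong ⊖_ }
      ; comm = ⊕-comm }
    ; *-cong = cong₂ _⊗_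
    ; *-assoc = ⊗-assoc
    ; *-identity = ⊗-identityˡ , ⊗-identityʳ
    ; distrib = ⊗-distribˡ-⊕ , ⊗-distribʳ-⊕ }
  ; *-comm = ⊗-comm }

Q5-commutativeRing : CommutativeRing 0ℓ 0ℓ
Q5-commutativeRing = record { isCommutativeRing = ⊕-⊗-isCommutativeRing }

open CommutativeRing Q5-commutativeRing using (commutativeSemiring)
  renaming (zeroˡ to ⊗-zeroˡ; zeroʳ to ⊗-zeroʳ)

Q5-ring : ACR.AlmostCommutativeRing 0ℓ 0ℓ
Q5-ring = ACR.fromCommutativeRing Q5-commutativeRing ≟0
  where
  ≟0 : (x : Q5) → Maybe (0Q5 ≡ x)
  ≟0 (q5 a b) with 0ℚ ℚ.≟ a | 0ℚ ℚ.≟ b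
  ... | yes refl | yes refl = just refl
  ... | _        | _        = nothing

infixl 6 _⊝_
_⊝_ : Q5 → Q5 → Q5
x ⊝ y = x ⊕ ⊖ y

private
  _/1 : ℕ → ℚ
  n /1 = mkℚ (+ n) 0 (λ p → ∣1⇒≡1 (proj₂ p))

  ℕtoℚ≡mkℚ : ∀ n → ℕtoℚ n ≡ n /1
  ℕtoℚ≡mkℚ n = ℚ.normalize-coprime {n} {0} (λ p → ∣1⇒≡1 (proj₂ p))

ℕtoℚ-+ : ∀ m n → ℕtoℚ (m + n) ≡ ℕtoℚ m ℚ.+ ℕtoℚ n
ℕtoℚ-+ m n rewrite ℕtoℚ≡mkℚ (m + n) | ℕtoℚ≡mkℚ m | ℕtoℚ≡mkℚ n =
  ℚ.toℚᵘ-injective (ℚᵘ.≃-trans (ℚᵘ.*≡* cross) (ℚᵘ.≃-sym (ℚ.toℚᵘ-homo-+ (m /1) (n /1))))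
  where
  cross : + (m + n) ℤ.* + 1 ≡ (+ m ℤ.* + 1 ℤ.+ + n ℤ.* + 1) ℤ.* + 1
  cross = begin
    + (m + n) ℤ.* + 1                   ≡⟨ ℤ.*-identityʳ _ ⟩
    + m ℤ.+ + n                         ≡⟨ cong₂ ℤ._+_ (ℤ.*-identityʳ (+ m)) (ℤ.*-identityʳ (+ n)) ⟨
    + m ℤ.* + 1 ℤ.+ + n ℤ.* + 1         ≡⟨ ℤ.*-identityʳ _ ⟨
    (+ m ℤ.* + 1 ℤ.+ + n ℤ.* + 1) ℤ.* + 1 ∎

ℕtoℚ-* : ∀ m n → ℕtoℚ (m * n) ≡ ℕtoℚ m ℚ.* ℕtoℚ n
ℕtoℚ-* m n rewrite ℕtoℚ≡mkℚ (m * n) | ℕtoℚ≡mkℚ m | ℕtoℚ≡mkℚ n =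
  ℚ.toℚᵘ-injective (ℚᵘ.≃-trans (ℚᵘ.*≡* (cong (ℤ._* + 1) (ℤ.pos-* m n))) (ℚᵘ.≃-sym (ℚ.toℚᵘ-homo-* (m /1) (n /1))))

ℕtoℚ-*-inverse : ∀ n → ℕtoℚ (suc n) ℚ.* (+ 1 ℚ./ suc n) ≡ 1ℚ
ℕtoℚ-*-inverse n rewrite ℕtoℚ≡mkℚ (suc n) =
  trans (cong (suc n /1 ℚ.*_) (ℚ.normalize-coprime {1} {n} (λ p → ∣1⇒≡1 (proj₁ p)))) (ℚ.*-inverseʳ (suc n /1))

fromℚ-* : ∀ p q → fromℚ (p ℚ.* q) ≡ fromℚ p ⊗ fromℚ q
fromℚ-* p q = cong₂ q5
  (sym (trans (cong (p ℚ.* q ℚ.+_) (ℚ.*-zeroʳ (ℕtoℚ 5 ℚ.* 0ℚ))) (ℚ.+-identityʳ (p ℚ.* q))))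
  (sym (cong₂ ℚ._+_ (ℚ.*-zeroʳ p) (ℚ.*-zeroˡ q)))

fromℕ-+ : ∀ m n → fromℕ (m + n) ≡ fromℕ m ⊕ fromℕ n
fromℕ-+ m n = cong fromℚ (ℕtoℚ-+ m n)

fromℕ-* : ∀ m n → fromℕ (m * n) ≡ fromℕ m ⊗ fromℕ n
fromℕ-* m n = trans (cong fromℚ (ℕtoℚ-* m n)) (fromℚ-* (ℕtoℚ m) (ℕtoℚ n))

fromℕ-^ : ∀ m n → fromℕ (m ℕ.^ n) ≡ fromℕ m ^ n
fromℕ-^ m zero    = refl
fromℕ-^ m (suc n) = trans (fromℕ-* m (m ℕ.^ n)) (cong (fromℕ m ⊗_) (fromℕ-^ m n))

fromℚ-powQ : ∀ q n → fromℚ (powQ q n) ≡ fromℚ q ^ n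
fromℚ-powQ q zero    = refl
fromℚ-powQ q (suc n) = trans (fromℚ-* q (powQ q n)) (cong (fromℚ q ⊗_) (fromℚ-powQ q n))

^-distribˡ-+-⊗ : ∀ x m n → x ^ (m + n) ≡ x ^ m ⊗ x ^ n
^-distribˡ-+-⊗ x zero    n = sym (⊗-identityˡ _)
^-distribˡ-+-⊗ x (suc m) n = trans (cong (x ⊗_) (^-distribˡ-+-⊗ x m n)) (sym (⊗-assoc x _ _))

^-split : ∀ x {i n} → i ≤ n → x ^ i ⊗ x ^ (n ∸ i) ≡ x ^ n
^-split x {i} i≤n = trans (sym (^-distribˡ-+-⊗ x i _)) (cong (x ^_) (ℕ.m+[n∸m]≡n i≤n))

^-distrib-⊗ : ∀ x y n → (x ⊗ y) ^ n ≡ x ^ n ⊗ y ^ n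
^-distrib-⊗ x y zero    = sym (⊗-identityˡ 1Q5)
^-distrib-⊗ x y (suc n) = trans (cong ((x ⊗ y) ⊗_) (^-distrib-⊗ x y n)) (interchange x y (x ^ n) (y ^ n))
  where
  interchange : ∀ a b c d → (a ⊗ b) ⊗ (c ⊗ d) ≡ (a ⊗ c) ⊗ (b ⊗ d)
  interchange = solve-∀ Q5-ring

1^n≡1 : ∀ n → 1Q5 ^ n ≡ 1Q5
1^n≡1 zero    = refl
1^n≡1 (suc n) = trans (cong (1Q5 ⊗_) (1^n≡1 n)) (⊗-identityˡ 1Q5)

^-*-assoc : ∀ x m n → x ^ (m * n) ≡ (x ^ m) ^ n
^-*-assoc x zero    n = sym (1^n≡1 n)
^-*-assoc x (suc m) n = begin
  x ^ (n + m * n)         ≡⟨ ^-distribˡ-+-⊗ x n (m * n) ⟩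
  x ^ n ⊗ x ^ (m * n)     ≡⟨ cong (x ^ n ⊗_) (^-*-assoc x m n) ⟩
  x ^ n ⊗ (x ^ m) ^ n     ≡⟨ ^-distrib-⊗ x (x ^ m) n ⟨
  (x ⊗ x ^ m) ^ n         ∎

-- Finite sums

Σ5-cong : ∀ n {f g : ℕ → Q5} → (∀ i → f i ≡ g i) → Σ5 n f ≡ Σ5 n g
Σ5-cong zero    f≗g = refl
Σ5-cong (suc n) f≗g = cong₂ _⊕_ (Σ5-cong n f≗g) (f≗g n)

Σ5-cong-< : ∀ n {f g : ℕ → Q5} → (∀ {i} → i < n → f i ≡ g i) → Σ5 n f ≡ Σ5 n g
Σ5-cong-< zero    f≗g = refl
Σ5-cong-< (suc n) f≗g = cong₂ _⊕_ (Σ5-cong-< n (λ i<n → f≗g (ℕ.m<n⇒m<1+n i<n))) (f≗g (ℕ.n<1+n n))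

Σ5-cong-≤ : ∀ n {f g : ℕ → Q5} → (∀ {i} → i ≤ n → f i ≡ g i) → Σ5 (suc n) f ≡ Σ5 (suc n) g
Σ5-cong-≤ n f≗g = Σ5-cong-< (suc n) (λ i<1+n → f≗g (ℕ.≤-pred i<1+n))

Σ5-head : ∀ n f → Σ5 (suc n) f ≡ f 0 ⊕ Σ5 n (λ i → f (suc i))
Σ5-head zero    f = ⊕-comm 0Q5 (f 0)
Σ5-head (suc n) f = trans (cong (_⊕ f (suc n)) (Σ5-head n f)) (⊕-assoc (f 0) _ _)

Σ5-zero : ∀ n {f} → (∀ {i} → i < n → f i ≡ 0Q5) → Σ5 n f ≡ 0Q5
Σ5-zero n f≗0 = trans (Σ5-cong-< n f≗0) (Σ0 n)
  where
  Σ0 : ∀ n → Σ5 n (λ _ → 0Q5) ≡ 0Q5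
  Σ0 zero    = refl
  Σ0 (suc n) = trans (cong (_⊕ 0Q5) (Σ0 n)) (⊕-identityʳ 0Q5)

Σ5-⊕ : ∀ n f g → Σ5 n (λ i → f i ⊕ g i) ≡ Σ5 n f ⊕ Σ5 n g
Σ5-⊕ zero    f g = sym (⊕-identityˡ 0Q5)
Σ5-⊕ (suc n) f g = trans (cong (_⊕ (f n ⊕ g n)) (Σ5-⊕ n f g)) (interchange (Σ5 n f) (Σ5 n g) (f n) (g n))
  where
  interchange : ∀ a b c d → (a ⊕ b) ⊕ (c ⊕ d) ≡ (a ⊕ c) ⊕ (b ⊕ d)
  interchange = solve-∀ Q5-ring

Σ5-⊖ : ∀ n f → Σ5 n (λ i → ⊖ f i) ≡ ⊖ Σ5 n f
Σ5-⊖ zero    f = refl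
Σ5-⊖ (suc n) f = trans (cong (_⊕ ⊖ f n) (Σ5-⊖ n f)) (⊖-distrib (Σ5 n f) (f n))
  where
  ⊖-distrib : ∀ a b → ⊖ a ⊕ ⊖ b ≡ ⊖ (a ⊕ b)
  ⊖-distrib = solve-∀ Q5-ring

Σ5-⊝ : ∀ n f g → Σ5 n (λ i → f i ⊝ g i) ≡ Σ5 n f ⊝ Σ5 n g
Σ5-⊝ n f g = trans (Σ5-⊕ n f (λ i → ⊖ g i)) (cong (Σ5 n f ⊕_) (Σ5-⊖ n g))

⊗-distribˡ-Σ5 : ∀ n c f → c ⊗ Σ5 n f ≡ Σ5 n (λ i → c ⊗ f i)
⊗-distribˡ-Σ5 zero    c f = ⊗-zeroʳ c
⊗-distribˡ-Σ5 (suc n) c f = trans (⊗-distribˡ-⊕ c _ _) (cong (_⊕ c ⊗ f n) (⊗-distribˡ-Σ5 n c f))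

Σ5-reverse : ∀ n f → Σ5 n f ≡ Σ5 n (λ k → f (n ∸ suc k))
Σ5-reverse zero    f = refl
Σ5-reverse (suc n) f = sym (begin
  Σ5 (suc n) (λ k → f (n ∸ k))              ≡⟨ Σ5-head n _ ⟩
  f n ⊕ Σ5 n (λ k → f (n ∸ suc k))          ≡⟨ cong (f n ⊕_) (Σ5-reverse n f) ⟨
  f n ⊕ Σ5 n f                              ≡⟨ ⊕-comm (f n) _ ⟩
  Σ5 n f ⊕ f n                              ∎)

Σ5-fromℚ : ∀ n f → Σ5 n (λ i → fromℚ (f i)) ≡ fromℚ (ΣQ n f)
Σ5-fromℚ zero    f = refl
Σ5-fromℚ (suc n) f = cong (_⊕ fromℚ (f n)) (Σ5-fromℚ n f)

Σ5≡foldr : ∀ n f → Σ5 n f ≡ foldr _⊕_ 0Q5 {n} (λ i → f (toℕ i))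
Σ5≡foldr zero    f = refl
Σ5≡foldr (suc n) f = trans (Σ5-head n f) (cong (f 0 ⊕_) (Σ5≡foldr n (λ i → f (suc i))))

ΣΔ : ℕ → (ℕ → ℕ → Q5) → Q5
ΣΔ n g = Σ5 (suc n) (λ i → Σ5 (suc (n ∸ i)) (g i))

ΣΔ-cong : ∀ n {g h} → (∀ {i k} → i + k ≤ n → g i k ≡ h i k) → ΣΔ n g ≡ ΣΔ n h
ΣΔ-cong n g≗h = Σ5-cong-≤ n (λ {i} i≤n → Σ5-cong-≤ (n ∸ i) (λ {k} k≤n∸i →
  g≗h (subst (_≤ n) (ℕ.+-comm k i) (ℕ.m≤o∸n⇒m+n≤o k i≤n k≤n∸i))))

ΣΔ-transpose : ∀ n g → ΣΔ n g ≡ ΣΔ n (flip g)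
ΣΔ-transpose zero    g = refl
ΣΔ-transpose (suc n) g = begin
  ΣΔ (suc n) g                            ≡⟨ first-column ⟩
  column ⊕ ΣΔ n (λ i k → g i (suc k))     ≡⟨ cong (column ⊕_) (ΣΔ-transpose n (λ i k → g i (suc k))) ⟩
  column ⊕ ΣΔ n (λ k i → g i (suc k))     ≡⟨ Σ5-head (suc n) (λ k → Σ5 (suc (suc n ∸ k)) (λ i → g i k)) ⟨
  ΣΔ (suc n) (flip g)                     ∎
  where
  column : Q5
  column = Σ5 (suc (suc n)) (λ i → g i 0)
  rest : ℕ → Q5
  rest i = Σ5 (suc n ∸ i) (λ k → g i (suc k))
  empty-row : rest (suc n) ≡ 0Q5
  empty-row rewrite ℕ.n∸n≡0 n = refl
  first-column : ΣΔ (suc n) g ≡ column ⊕ ΣΔ n (λ i k → g i (suc k))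
  first-column = begin
    ΣΔ (suc n) g
      ≡⟨ Σ5-cong (suc (suc n)) (λ i → Σ5-head (suc n ∸ i) (g i)) ⟩
    Σ5 (suc (suc n)) (λ i → g i 0 ⊕ rest i)
      ≡⟨ Σ5-⊕ (suc (suc n)) (λ i → g i 0) rest ⟩
    column ⊕ (Σ5 (suc n) rest ⊕ rest (suc n))
      ≡⟨ cong (λ e → column ⊕ (Σ5 (suc n) rest ⊕ e)) empty-row ⟩
    column ⊕ (Σ5 (suc n) rest ⊕ 0Q5)
      ≡⟨ cong (column ⊕_) (⊕-identityʳ (Σ5 (suc n) rest)) ⟩
    column ⊕ Σ5 (suc n) rest
      ≡⟨ cong (column ⊕_) (Σ5-cong-≤ n (λ {i} i≤n → cong (λ e → Σ5 e (λ k → g i (suc k))) (ℕ.+-∸-assoc 1 i≤n))) ⟩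
    column ⊕ ΣΔ n (λ i k → g i (suc k)) ∎

-- Binomial coefficients

choose : ℕ → ℕ → Q5
choose n k = fromℕ (n C k)

nCk*k![n∸k]!≡n! : ∀ {n k} → k ≤ n → (n C k) * (k ! * (n ∸ k) !) ≡ n !
nCk*k![n∸k]!≡n! {n} {k} k≤n =
  trans (cong (_* (k ! * (n ∸ k) !)) (nCk≡n!/k![n-k]! k≤n))
        (m/n*n≡m {{ℕ._!*_!≢0 k (n ∸ k)}} (k![n∸k]!∣n! k≤n))

[1+n]Cn≡1+n : ∀ n → suc n C n ≡ suc n
[1+n]Cn≡1+n n = trans (nCk≡nC[n∸k] (ℕ.n≤1+n n)) (trans (cong (suc n C_) (ℕ.m+n∸n≡m 1 n)) (nC1≡n (suc n)))

[m∸n]∸o≡[m∸o]∸n : ∀ m n o → m ∸ n ∸ o ≡ m ∸ o ∸ n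
[m∸n]∸o≡[m∸o]∸n m n o =
  trans (ℕ.∸-+-assoc m n o) (trans (cong (m ∸_) (ℕ.+-comm n o)) (sym (ℕ.∸-+-assoc m o n)))

nCk*[n∸k]Ci*k!i![n∸k∸i]!≡n! : ∀ {n k i} → k ≤ n → i ≤ n ∸ k →
  ((n C k) * ((n ∸ k) C i)) * (k ! * (i ! * (n ∸ k ∸ i) !)) ≡ n !
nCk*[n∸k]Ci*k!i![n∸k∸i]!≡n! {n} {k} {i} k≤n i≤n∸k = begin
  ((n C k) * ((n ∸ k) C i)) * (k ! * (i ! * (n ∸ k ∸ i) !))
    ≡⟨ regroup (n C k) ((n ∸ k) C i) (k !) (i !) ((n ∸ k ∸ i) !) ⟩
  (n C k) * (k ! * (((n ∸ k) C i) * (i ! * (n ∸ k ∸ i) !)))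
    ≡⟨ cong (λ e → (n C k) * (k ! * e)) (nCk*k![n∸k]!≡n! i≤n∸k) ⟩
  (n C k) * (k ! * (n ∸ k) !)
    ≡⟨ nCk*k![n∸k]!≡n! k≤n ⟩
  n ! ∎
  where
  regroup : ∀ a b c d e → (a * b) * (c * (d * e)) ≡ a * (c * (b * (d * e)))
  regroup = ℕ-solve

nCk*[n∸k]Ci≡nCi*[n∸i]Ck : ∀ {n k i} → i + k ≤ n → (n C k) * ((n ∸ k) C i) ≡ (n C i) * ((n ∸ i) C k)
nCk*[n∸k]Ci≡nCi*[n∸i]Ck {n} {k} {i} i+k≤n =
  ℕ.*-cancelʳ-≡ _ _ (k ! * (i ! * (n ∸ k ∸ i) !)) {{nonZero}} (begin
    ((n C k) * ((n ∸ k) C i)) * (k ! * (i ! * (n ∸ k ∸ i) !))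
      ≡⟨ nCk*[n∸k]Ci*k!i![n∸k∸i]!≡n! k≤n i≤n∸k ⟩
    n !
      ≡⟨ nCk*[n∸k]Ci*k!i![n∸k∸i]!≡n! i≤n k≤n∸i ⟨
    ((n C i) * ((n ∸ i) C k)) * (i ! * (k ! * (n ∸ i ∸ k) !))
      ≡⟨ cong (((n C i) * ((n ∸ i) C k)) *_) factorials-comm ⟩
    ((n C i) * ((n ∸ i) C k)) * (k ! * (i ! * (n ∸ k ∸ i) !)) ∎)
  where
  k+i≤n : k + i ≤ n
  k+i≤n = subst (_≤ n) (ℕ.+-comm i k) i+k≤n
  k≤n : k ≤ n
  k≤n = ℕ.≤-trans (ℕ.m≤m+n k i) k+i≤n
  i≤n : i ≤ n
  i≤n = ℕ.≤-trans (ℕ.m≤m+n i k) i+k≤n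
  i≤n∸k : i ≤ n ∸ k
  i≤n∸k = ℕ.m+n≤o⇒m≤o∸n i i+k≤n
  k≤n∸i : k ≤ n ∸ i
  k≤n∸i = ℕ.m+n≤o⇒m≤o∸n k k+i≤n
  nonZero : ℕ.NonZero (k ! * (i ! * (n ∸ k ∸ i) !))
  nonZero = ℕ.m*n≢0 (k !) _ {{ℕ._!≢0 k}} {{ℕ._!*_!≢0 i (n ∸ k ∸ i)}}
  factorials-comm : i ! * (k ! * (n ∸ i ∸ k) !) ≡ k ! * (i ! * (n ∸ k ∸ i) !)
  factorials-comm = trans (ℕ.*-comm (i !) _) (trans (ℕ.*-assoc (k !) _ (i !))
    (cong (λ e → k ! * e) (trans (ℕ.*-comm ((n ∸ i ∸ k) !) (i !))
      (cong (λ e → i ! * e !) ([m∸n]∸o≡[m∸o]∸n n i k)))))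

choose-comm : ∀ {n k i} → i + k ≤ n → choose n k ⊗ choose (n ∸ k) i ≡ choose n i ⊗ choose (n ∸ i) k
choose-comm {n} {k} {i} i+k≤n = begin
  choose n k ⊗ choose (n ∸ k) i      ≡⟨ fromℕ-* (n C k) ((n ∸ k) C i) ⟨
  fromℕ ((n C k) * ((n ∸ k) C i))    ≡⟨ cong fromℕ (nCk*[n∸k]Ci≡nCi*[n∸i]Ck {n} {k} {i} i+k≤n) ⟩
  fromℕ ((n C i) * ((n ∸ i) C k))    ≡⟨ fromℕ-* (n C i) ((n ∸ i) C k) ⟩
  choose n i ⊗ choose (n ∸ i) k      ∎

open RawSemiring (CommutativeSemiring.rawSemiring commutativeSemiring) using ()
  renaming (_^_ to _^ᴿ_; _×_ to _×ᴿ_)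

^≡^ᴿ : ∀ x n → x ^ n ≡ x ^ᴿ n
^≡^ᴿ x zero    = refl
^≡^ᴿ x (suc n) = cong (x ⊗_) (^≡^ᴿ x n)

×ᴿ≡fromℕ⊗ : ∀ n x → n ×ᴿ x ≡ fromℕ n ⊗ x
×ᴿ≡fromℕ⊗ zero    x = sym (⊗-zeroˡ x)
×ᴿ≡fromℕ⊗ (suc n) x = begin
  x ⊕ n ×ᴿ x                  ≡⟨ cong₂ _⊕_ (sym (⊗-identityˡ x)) (×ᴿ≡fromℕ⊗ n x) ⟩
  1Q5 ⊗ x ⊕ fromℕ n ⊗ x       ≡⟨ ⊗-distribʳ-⊕ x 1Q5 (fromℕ n) ⟨
  (1Q5 ⊕ fromℕ n) ⊗ x         ≡⟨ cong (_⊗ x) (fromℕ-+ 1 n) ⟨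
  fromℕ (suc n) ⊗ x           ∎

binomial-theorem : ∀ n x y → (x ⊕ y) ^ n ≡ Σ5 (suc n) (λ k → choose n k ⊗ x ^ k ⊗ y ^ (n ∸ k))
binomial-theorem n x y = begin
  (x ⊕ y) ^ n
    ≡⟨ ^≡^ᴿ (x ⊕ y) n ⟩
  (x ⊕ y) ^ᴿ n
    ≡⟨ Binomial.theorem commutativeSemiring n x y ⟩
  foldr _⊕_ 0Q5 {suc n} (λ k → term (toℕ k))
    ≡⟨ Σ5≡foldr (suc n) term ⟨
  Σ5 (suc n) term
    ≡⟨ Σ5-cong (suc n) (λ k → trans (×ᴿ≡fromℕ⊗ (n C k) _)
         (trans (cong₂ (λ a b → choose n k ⊗ (a ⊗ b)) (sym (^≡^ᴿ x k)) (sym (^≡^ᴿ y (n ∸ k))))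
                (sym (⊗-assoc (choose n k) _ _)))) ⟩
  Σ5 (suc n) (λ k → choose n k ⊗ x ^ k ⊗ y ^ (n ∸ k)) ∎
  where
  term : ℕ → Q5
  term k = (n C k) ×ᴿ (x ^ᴿ k ⊗ y ^ᴿ (n ∸ k))

binomial-convolution-comm : ∀ n f g h →
  Σ5 (suc n) (λ k → choose n k ⊗ f k ⊗ Σ5 (suc (n ∸ k)) (λ i → choose (n ∸ k) i ⊗ g i ⊗ h (n ∸ k ∸ i)))
    ≡ Σ5 (suc n) (λ i → choose n i ⊗ g i ⊗ Σ5 (suc (n ∸ i)) (λ k → choose (n ∸ i) k ⊗ f k ⊗ h (n ∸ i ∸ k)))
binomial-convolution-comm n f g h = begin
  Σ5 (suc n) (λ k → choose n k ⊗ f k ⊗ Σ5 (suc (n ∸ k)) (λ i → choose (n ∸ k) i ⊗ g i ⊗ h (n ∸ k ∸ i)))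
    ≡⟨ Σ5-cong (suc n) (factor-out f g) ⟩
  ΣΔ n (term f g)
    ≡⟨ ΣΔ-transpose n (term f g) ⟩
  ΣΔ n (flip (term f g))
    ≡⟨ ΣΔ-cong n (λ {i} {k} i+k≤n → term-comm {i} {k} i+k≤n) ⟩
  ΣΔ n (term g f)
    ≡⟨ Σ5-cong (suc n) (factor-out g f) ⟨
  Σ5 (suc n) (λ i → choose n i ⊗ g i ⊗ Σ5 (suc (n ∸ i)) (λ k → choose (n ∸ i) k ⊗ f k ⊗ h (n ∸ i ∸ k))) ∎
  where
  term : (ℕ → Q5) → (ℕ → Q5) → ℕ → ℕ → Q5
  term u v k i = choose n k ⊗ u k ⊗ (choose (n ∸ k) i ⊗ v i ⊗ h (n ∸ k ∸ i))
  factor-out : ∀ u v k →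
    choose n k ⊗ u k ⊗ Σ5 (suc (n ∸ k)) (λ i → choose (n ∸ k) i ⊗ v i ⊗ h (n ∸ k ∸ i))
      ≡ Σ5 (suc (n ∸ k)) (term u v k)
  factor-out u v k = ⊗-distribˡ-Σ5 (suc (n ∸ k)) (choose n k ⊗ u k) (λ i → choose (n ∸ k) i ⊗ v i ⊗ h (n ∸ k ∸ i))
  regroup : ∀ a b c d e → a ⊗ c ⊗ (b ⊗ d ⊗ e) ≡ (a ⊗ b) ⊗ (c ⊗ d ⊗ e)
  regroup = solve-∀ Q5-ring
  term-comm : ∀ {i k} → i + k ≤ n → term f g k i ≡ term g f i k
  term-comm {i} {k} i+k≤n = begin
    term f g k i
      ≡⟨ regroup (choose n k) (choose (n ∸ k) i) (f k) (g i) (h (n ∸ k ∸ i)) ⟩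
    (choose n k ⊗ choose (n ∸ k) i) ⊗ (f k ⊗ g i ⊗ h (n ∸ k ∸ i))
      ≡⟨ cong₂ _⊗_ (choose-comm {n} {k} {i} i+k≤n) (cong₂ _⊗_ (⊗-comm (f k) (g i)) (cong h ([m∸n]∸o≡[m∸o]∸n n k i))) ⟩
    (choose n i ⊗ choose (n ∸ i) k) ⊗ (g i ⊗ f k ⊗ h (n ∸ i ∸ k))
      ≡⟨ regroup (choose n i) (choose (n ∸ i) k) (g i) (f k) (h (n ∸ i ∸ k)) ⟨
    term g f i k ∎

-- Bernoulli numbers and polynomials

bernTable-stable : ∀ {m k} → k ≤ m → bernTable m k ≡ bernoulliNum k
bernTable-stable {zero}  z≤n = refl
bernTable-stable {suc m} {k} k≤1+m with ℕ.m≤n⇒m<n∨m≡n k≤1+m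
... | inj₂ refl = refl
... | inj₁ k<1+m with k ≡ᵇ suc m in eq
...   | true  = ⊥-elim (ℕ.<-irrefl (ℕ.≡ᵇ⇒≡ k (suc m) (subst T (sym eq) tt)) k<1+m)
...   | false = bernTable-stable (ℕ.≤-pred k<1+m)

bernoulliNum-suc : ∀ m → bernoulliNum (suc m) ≡
  ℚ.- ((+ 1 ℚ./ suc (suc m)) ℚ.* ΣQ (suc m) (λ i → ℕtoℚ (suc (suc m) C i) ℚ.* bernTable m i))
bernoulliNum-suc m with suc m ≡ᵇ suc m | ℕ.≡⇒≡ᵇ (suc m) (suc m) refl
... | true  | _  = refl
... | false | ()

bernoulliNum-recurrence : ∀ m →
  ΣQ (suc (suc m)) (λ i → ℕtoℚ (suc (suc m) C i) ℚ.* bernoulliNum i) ≡ 0ℚ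
bernoulliNum-recurrence m = begin
  ΣQ (suc m) (λ i → ℕtoℚ (suc (suc m) C i) ℚ.* bernoulliNum i) ℚ.+ ℕtoℚ (suc (suc m) C suc m) ℚ.* bernoulliNum (suc m)
    ≡⟨ cong₂ (λ a b → a ℚ.+ ℕtoℚ b ℚ.* bernoulliNum (suc m)) earlier-terms ([1+n]Cn≡1+n (suc m)) ⟩
  S ℚ.+ t ℚ.* bernoulliNum (suc m)
    ≡⟨ cong (λ e → S ℚ.+ t ℚ.* e) (bernoulliNum-suc m) ⟩
  S ℚ.+ t ℚ.* ℚ.- ((+ 1 ℚ./ suc (suc m)) ℚ.* S)
    ≡⟨ regroup S t (+ 1 ℚ./ suc (suc m)) ⟩
  S ℚ.+ ℚ.- ((t ℚ.* (+ 1 ℚ./ suc (suc m))) ℚ.* S)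
    ≡⟨ cong (λ e → S ℚ.+ ℚ.- (e ℚ.* S)) (ℕtoℚ-*-inverse (suc m)) ⟩
  S ℚ.+ ℚ.- (1ℚ ℚ.* S)
    ≡⟨ cong (λ e → S ℚ.+ ℚ.- e) (ℚ.*-identityˡ S) ⟩
  S ℚ.+ ℚ.- S
    ≡⟨ ℚ.+-inverseʳ S ⟩
  0ℚ ∎
  where
  S : ℚ
  S = ΣQ (suc m) (λ i → ℕtoℚ (suc (suc m) C i) ℚ.* bernTable m i)
  t : ℚ
  t = ℕtoℚ (suc (suc m))
  earlier-terms : ΣQ (suc m) (λ i → ℕtoℚ (suc (suc m) C i) ℚ.* bernoulliNum i) ≡ S
  earlier-terms = ΣQ-cong (suc m) (λ {i} i<1+m → cong (ℕtoℚ (suc (suc m) C i) ℚ.*_) (sym (bernTable-stable (ℕ.≤-pred i<1+m))))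
    where
    ΣQ-cong : ∀ n {f g : ℕ → ℚ} → (∀ {i} → i < n → f i ≡ g i) → ΣQ n f ≡ ΣQ n g
    ΣQ-cong zero    f≗g = refl
    ΣQ-cong (suc n) f≗g = cong₂ ℚ._+_ (ΣQ-cong n (λ i<n → f≗g (ℕ.m<n⇒m<1+n i<n))) (f≗g (ℕ.n<1+n n))
  regroup : ∀ S t r → S ℚ.+ t ℚ.* ℚ.- (r ℚ.* S) ≡ S ℚ.+ ℚ.- ((t ℚ.* r) ℚ.* S)
  regroup = solve-∀ ℚ-ring

B : ℕ → Q5
B n = fromℚ (bernoulliNum n)

δ₁ : ℕ → Q5
δ₁ 1 = 1Q5
δ₁ _ = 0Q5

binomial-sum-bernoulli : ∀ n → Σ5 (suc n) (λ i → choose n i ⊗ B i) ≡ B n ⊕ δ₁ n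
binomial-sum-bernoulli zero          = refl
binomial-sum-bernoulli (suc zero)    = refl
binomial-sum-bernoulli (suc (suc m)) = begin
  Σ5 (suc (suc m)) (λ i → choose n i ⊗ B i) ⊕ choose n n ⊗ B n
    ≡⟨ cong₂ _⊕_ lower-terms (cong (λ e → fromℕ e ⊗ B n) (nCn≡1 n)) ⟩
  0Q5 ⊕ 1Q5 ⊗ B n
    ≡⟨ trans (⊕-identityˡ (1Q5 ⊗ B n)) (⊗-identityˡ (B n)) ⟩
  B n
    ≡⟨ ⊕-identityʳ (B n) ⟨
  B n ⊕ 0Q5 ∎
  where
  n = suc (suc m)
  lower-terms : Σ5 n (λ i → choose n i ⊗ B i) ≡ 0Q5
  lower-terms = begin
    Σ5 n (λ i → choose n i ⊗ B i)
      ≡⟨ Σ5-cong n (λ i → sym (fromℚ-* (ℕtoℚ (n C i)) (bernoulliNum i))) ⟩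
    Σ5 n (λ i → fromℚ (ℕtoℚ (n C i) ℚ.* bernoulliNum i))
      ≡⟨ Σ5-fromℚ n (λ i → ℕtoℚ (n C i) ℚ.* bernoulliNum i) ⟩
    fromℚ (ΣQ n (λ i → ℕtoℚ (n C i) ℚ.* bernoulliNum i))
      ≡⟨ cong fromℚ (bernoulliNum-recurrence m) ⟩
    0Q5 ∎

-- homBernoulli n s z = s^n B_n(z/s), written so that it makes sense for s = 0.
homBernoulli : ℕ → Q5 → Q5 → Q5
homBernoulli n s z = Σ5 (suc n) (λ i → choose n i ⊗ (B i ⊗ s ^ i) ⊗ z ^ (n ∸ i))

homBernoulli-scale : ∀ n s x → s ^ n ⊗ bernoulliPoly n x ≡ homBernoulli n s (s ⊗ x)
homBernoulli-scale n s x = begin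
  s ^ n ⊗ bernoulliPoly n x
    ≡⟨ ⊗-distribˡ-Σ5 (suc n) (s ^ n) _ ⟩
  Σ5 (suc n) (λ i → s ^ n ⊗ (fromℚ (ℕtoℚ (n C i) ℚ.* bernoulliNum i) ⊗ x ^ (n ∸ i)))
    ≡⟨ Σ5-cong-≤ n term ⟩
  homBernoulli n s (s ⊗ x) ∎
  where
  regroup : ∀ p q c b y → (p ⊗ q) ⊗ (c ⊗ b ⊗ y) ≡ c ⊗ (b ⊗ p) ⊗ (q ⊗ y)
  regroup = solve-∀ Q5-ring
  term : ∀ {i} → i ≤ n →
    s ^ n ⊗ (fromℚ (ℕtoℚ (n C i) ℚ.* bernoulliNum i) ⊗ x ^ (n ∸ i))
      ≡ choose n i ⊗ (B i ⊗ s ^ i) ⊗ (s ⊗ x) ^ (n ∸ i)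
  term {i} i≤n = begin
    s ^ n ⊗ (fromℚ (ℕtoℚ (n C i) ℚ.* bernoulliNum i) ⊗ x ^ (n ∸ i))
      ≡⟨ cong₂ (λ p c → p ⊗ (c ⊗ x ^ (n ∸ i))) (sym (^-split s i≤n)) (fromℚ-* (ℕtoℚ (n C i)) (bernoulliNum i)) ⟩
    (s ^ i ⊗ s ^ (n ∸ i)) ⊗ (choose n i ⊗ B i ⊗ x ^ (n ∸ i))
      ≡⟨ regroup (s ^ i) (s ^ (n ∸ i)) (choose n i) (B i) (x ^ (n ∸ i)) ⟩
    choose n i ⊗ (B i ⊗ s ^ i) ⊗ (s ^ (n ∸ i) ⊗ x ^ (n ∸ i))
      ≡⟨ cong (choose n i ⊗ (B i ⊗ s ^ i) ⊗_) (^-distrib-⊗ s x (n ∸ i)) ⟨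
    choose n i ⊗ (B i ⊗ s ^ i) ⊗ (s ⊗ x) ^ (n ∸ i) ∎

-- The Appell property B_n(x + y) = Σ_k C(n,k) y^k B_(n-k)(x), in homogeneous form.
homBernoulli-translate : ∀ n a s x →
  Σ5 (suc n) (λ k → choose n k ⊗ a ^ k ⊗ (s ^ (n ∸ k) ⊗ bernoulliPoly (n ∸ k) x))
    ≡ homBernoulli n s (a ⊕ s ⊗ x)
homBernoulli-translate n a s x = begin
  Σ5 (suc n) (λ k → choose n k ⊗ a ^ k ⊗ (s ^ (n ∸ k) ⊗ bernoulliPoly (n ∸ k) x))
    ≡⟨ Σ5-cong (suc n) (λ k → cong (choose n k ⊗ a ^ k ⊗_) (homBernoulli-scale (n ∸ k) s x)) ⟩
  Σ5 (suc n) (λ k → choose n k ⊗ a ^ k ⊗ homBernoulli (n ∸ k) s (s ⊗ x))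
    ≡⟨ binomial-convolution-comm n (a ^_) (λ i → B i ⊗ s ^ i) ((s ⊗ x) ^_) ⟩
  Σ5 (suc n) (λ i → choose n i ⊗ (B i ⊗ s ^ i) ⊗
    Σ5 (suc (n ∸ i)) (λ k → choose (n ∸ i) k ⊗ a ^ k ⊗ (s ⊗ x) ^ (n ∸ i ∸ k)))
    ≡⟨ Σ5-cong (suc n) (λ i → cong (choose n i ⊗ (B i ⊗ s ^ i) ⊗_) (binomial-theorem (n ∸ i) a (s ⊗ x))) ⟨
  homBernoulli n s (a ⊕ s ⊗ x) ∎

homBernoulli-diagonal : ∀ n s → homBernoulli n s s ≡ s ^ n ⊗ (B n ⊕ δ₁ n)
homBernoulli-diagonal n s = begin
  homBernoulli n s s
    ≡⟨ Σ5-cong-≤ n term ⟩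
  Σ5 (suc n) (λ i → s ^ n ⊗ (choose n i ⊗ B i))
    ≡⟨ ⊗-distribˡ-Σ5 (suc n) (s ^ n) (λ i → choose n i ⊗ B i) ⟨
  s ^ n ⊗ Σ5 (suc n) (λ i → choose n i ⊗ B i)
    ≡⟨ cong (s ^ n ⊗_) (binomial-sum-bernoulli n) ⟩
  s ^ n ⊗ (B n ⊕ δ₁ n) ∎
  where
  regroup : ∀ c b p q → c ⊗ (b ⊗ p) ⊗ q ≡ (p ⊗ q) ⊗ (c ⊗ b)
  regroup = solve-∀ Q5-ring
  term : ∀ {i} → i ≤ n → choose n i ⊗ (B i ⊗ s ^ i) ⊗ s ^ (n ∸ i) ≡ s ^ n ⊗ (choose n i ⊗ B i)
  term {i} i≤n = trans (regroup (choose n i) (B i) (s ^ i) (s ^ (n ∸ i)))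
                       (cong (_⊗ (choose n i ⊗ B i)) (^-split s i≤n))

homBernoulli-reverse : ∀ n s z →
  homBernoulli n s z ≡ Σ5 (suc n) (λ k → choose n k ⊗ z ^ k ⊗ (s ^ (n ∸ k) ⊗ B (n ∸ k)))
homBernoulli-reverse n s z = trans (Σ5-reverse (suc n) _) (Σ5-cong-≤ n term)
  where
  regroup : ∀ c b p q → c ⊗ (b ⊗ p) ⊗ q ≡ c ⊗ q ⊗ (p ⊗ b)
  regroup = solve-∀ Q5-ring
  term : ∀ {k} → k ≤ n →
    choose n (n ∸ k) ⊗ (B (n ∸ k) ⊗ s ^ (n ∸ k)) ⊗ z ^ (n ∸ (n ∸ k))
      ≡ choose n k ⊗ z ^ k ⊗ (s ^ (n ∸ k) ⊗ B (n ∸ k))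
  term {k} k≤n = trans
    (cong₂ (λ c e → c ⊗ (B (n ∸ k) ⊗ s ^ (n ∸ k)) ⊗ z ^ e)
           (cong fromℕ (sym (nCk≡nC[n∸k] k≤n))) (ℕ.m∸[m∸n]≡n k≤n))
    (regroup (choose n k) (B (n ∸ k)) (s ^ (n ∸ k)) (z ^ k))

Σ5-δ₁ : ∀ m (f : ℕ → Q5) → Σ5 (suc (suc m)) (λ k → f k ⊗ δ₁ (suc m ∸ k)) ≡ f m
Σ5-δ₁ m f = begin
  (Σ5 m F ⊕ F m) ⊕ F (suc m)
    ≡⟨ cong₂ (λ a b → (a ⊕ F m) ⊕ b) (Σ5-zero m δ₁-vanishes) (cong (λ e → f (suc m) ⊗ δ₁ e) (ℕ.n∸n≡0 m)) ⟩
  (0Q5 ⊕ F m) ⊕ f (suc m) ⊗ 0Q5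
    ≡⟨ cong₂ _⊕_ (⊕-identityˡ (F m)) (⊗-zeroʳ (f (suc m))) ⟩
  F m ⊕ 0Q5
    ≡⟨ ⊕-identityʳ (F m) ⟩
  f m ⊗ δ₁ (suc m ∸ m)
    ≡⟨ cong (λ e → f m ⊗ δ₁ e) (ℕ.m+n∸n≡m 1 m) ⟩
  f m ⊗ 1Q5
    ≡⟨ ⊗-identityʳ (f m) ⟩
  f m ∎
  where
  F : ℕ → Q5
  F k = f k ⊗ δ₁ (suc m ∸ k)
  δ₁-suc-∸ : ∀ {k m} → k < m → δ₁ (suc m ∸ k) ≡ 0Q5
  δ₁-suc-∸ {zero}  {suc m} _             = refl
  δ₁-suc-∸ {suc k} {suc m} (s≤s k<m) = δ₁-suc-∸ k<m
  δ₁-vanishes : ∀ {k} → k < m → F k ≡ 0Q5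
  δ₁-vanishes {k} k<m = trans (cong (f k ⊗_) (δ₁-suc-∸ k<m)) (⊗-zeroʳ (f k))

-- The difference equation B_n(x + 1) - B_n(x) = n x^(n-1), in homogeneous form.
homBernoulli-difference : ∀ m s z →
  homBernoulli (suc m) s (z ⊕ s) ≡ homBernoulli (suc m) s z ⊕ fromℕ (suc m) ⊗ s ⊗ z ^ m
homBernoulli-difference m s z = begin
  homBernoulli n s (z ⊕ s)
    ≡⟨ Σ5-cong (suc n) (λ i → cong (choose n i ⊗ (B i ⊗ s ^ i) ⊗_) (binomial-theorem (n ∸ i) z s)) ⟩
  Σ5 (suc n) (λ i → choose n i ⊗ (B i ⊗ s ^ i) ⊗
    Σ5 (suc (n ∸ i)) (λ k → choose (n ∸ i) k ⊗ z ^ k ⊗ s ^ (n ∸ i ∸ k)))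
    ≡⟨ binomial-convolution-comm n (z ^_) (λ i → B i ⊗ s ^ i) (s ^_) ⟨
  Σ5 (suc n) (λ k → choose n k ⊗ z ^ k ⊗ homBernoulli (n ∸ k) s s)
    ≡⟨ Σ5-cong (suc n) (λ k → trans (cong (choose n k ⊗ z ^ k ⊗_) (homBernoulli-diagonal (n ∸ k) s))
                                    (expand (choose n k) (z ^ k) (s ^ (n ∸ k)) (B (n ∸ k)) (δ₁ (n ∸ k)))) ⟩
  Σ5 (suc n) (λ k → choose n k ⊗ z ^ k ⊗ (s ^ (n ∸ k) ⊗ B (n ∸ k)) ⊕ choose n k ⊗ z ^ k ⊗ s ^ (n ∸ k) ⊗ δ₁ (n ∸ k))
    ≡⟨ Σ5-⊕ (suc n) (λ k → choose n k ⊗ z ^ k ⊗ (s ^ (n ∸ k) ⊗ B (n ∸ k))) (λ k → P k ⊗ δ₁ (n ∸ k)) ⟩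
  Σ5 (suc n) (λ k → choose n k ⊗ z ^ k ⊗ (s ^ (n ∸ k) ⊗ B (n ∸ k)))
    ⊕ Σ5 (suc n) (λ k → choose n k ⊗ z ^ k ⊗ s ^ (n ∸ k) ⊗ δ₁ (n ∸ k))
    ≡⟨ cong₂ _⊕_ (sym (homBernoulli-reverse n s z)) top-sum ⟩
  homBernoulli n s z ⊕ choose n m ⊗ z ^ m ⊗ s ^ (n ∸ m)
    ≡⟨ cong (homBernoulli n s z ⊕_) top-term ⟩
  homBernoulli n s z ⊕ fromℕ n ⊗ s ⊗ z ^ m ∎
  where
  n = suc m
  P : ℕ → Q5
  P k = choose n k ⊗ z ^ k ⊗ s ^ (n ∸ k)
  top-sum : Σ5 (suc n) (λ k → P k ⊗ δ₁ (n ∸ k)) ≡ P m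
  top-sum = Σ5-δ₁ m P
  expand : ∀ c p q b d → c ⊗ p ⊗ (q ⊗ (b ⊕ d)) ≡ c ⊗ p ⊗ (q ⊗ b) ⊕ c ⊗ p ⊗ q ⊗ d
  expand = solve-∀ Q5-ring
  top-term : choose n m ⊗ z ^ m ⊗ s ^ (n ∸ m) ≡ fromℕ n ⊗ s ⊗ z ^ m
  top-term = begin
    choose n m ⊗ z ^ m ⊗ s ^ (n ∸ m)
      ≡⟨ cong₂ (λ c e → fromℕ c ⊗ z ^ m ⊗ s ^ e) ([1+n]Cn≡1+n m) (ℕ.m+n∸n≡m 1 m) ⟩
    fromℕ n ⊗ z ^ m ⊗ (s ⊗ 1Q5)
      ≡⟨ regroup (fromℕ n) (z ^ m) s ⟩
    fromℕ n ⊗ s ⊗ z ^ m ∎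
    where
    regroup : ∀ a b c → a ⊗ b ⊗ (c ⊗ 1Q5) ≡ a ⊗ c ⊗ b
    regroup = solve-∀ Q5-ring

homBernoulli-difference₂ : ∀ m s z →
  homBernoulli (suc m) s (z ⊕ s ⊕ s) ⊝ homBernoulli (suc m) s z
    ≡ fromℕ (suc m) ⊗ s ⊗ ((z ⊕ s) ^ m ⊕ z ^ m)
homBernoulli-difference₂ m s z = begin
  homBernoulli (suc m) s (z ⊕ s ⊕ s) ⊝ H
    ≡⟨ cong (_⊝ H) (trans (homBernoulli-difference m s (z ⊕ s))
                          (cong (_⊕ N ⊗ s ⊗ (z ⊕ s) ^ m) (homBernoulli-difference m s z))) ⟩
  (H ⊕ N ⊗ s ⊗ z ^ m ⊕ N ⊗ s ⊗ (z ⊕ s) ^ m) ⊝ H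
    ≡⟨ cancel H N s (z ^ m) ((z ⊕ s) ^ m) ⟩
  N ⊗ s ⊗ ((z ⊕ s) ^ m ⊕ z ^ m) ∎
  where
  H = homBernoulli (suc m) s z
  N = fromℕ (suc m)
  cancel : ∀ h N s p q → (h ⊕ N ⊗ s ⊗ p ⊕ N ⊗ s ⊗ q) ⊝ h ≡ N ⊗ s ⊗ (q ⊕ p)
  cancel = solve-∀ Q5-ring

-- Fibonacci and Lucas numbers

fibonacci-like-unique : ∀ (u v : ℕ → ℕ) →
  (∀ n → u (2 + n) ≡ u (1 + n) + u n) → (∀ n → v (2 + n) ≡ v (1 + n) + v n) →
  u 0 ≡ v 0 → u 1 ≡ v 1 → ∀ n → u n ≡ v n
fibonacci-like-unique u v recᵤ recᵥ u₀≡v₀ u₁≡v₁ = go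
  where
  go : ∀ n → u n ≡ v n
  go zero          = u₀≡v₀
  go (suc zero)    = u₁≡v₁
  go (suc (suc n)) = trans (recᵤ n) (trans (cong₂ _+_ (go (suc n)) (go n)) (sym (recᵥ n)))

lucas[n+3] : ∀ n → lucas (n + 3) ≡ 5 * fib n + 2 * lucas n
lucas[n+3] = fibonacci-like-unique (λ n → lucas (n + 3)) (λ n → 5 * fib n + 2 * lucas n)
  (λ n → refl) (λ n → regroup (fib (suc n)) (fib n) (lucas (suc n)) (lucas n)) refl refl
  where
  regroup : ∀ a b c d → 5 * (a + b) + 2 * (c + d) ≡ (5 * a + 2 * c) + (5 * b + 2 * d)
  regroup = ℕ-solve

5*fib[3+n] : ∀ n → 5 * fib (3 + n) ≡ lucas n + 2 * lucas (3 + n)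
5*fib[3+n] = fibonacci-like-unique (λ n → 5 * fib (3 + n)) (λ n → lucas n + 2 * lucas (3 + n))
  (λ n → ℕ.*-distribˡ-+ 5 (fib (4 + n)) (fib (3 + n)))
  (λ n → regroup (lucas (suc n)) (lucas n) (lucas (4 + n)) (lucas (3 + n))) refl refl
  where
  regroup : ∀ a b c d → (a + b) + 2 * (c + d) ≡ (a + 2 * c) + (b + 2 * d)
  regroup = ℕ-solve

β : Q5
β = q5 ½ (ℚ.- ½)

binet : ∀ γ r → γ ⊗ γ ≡ γ ⊕ 1Q5 → fromℕ 2 ⊗ γ ≡ 1Q5 ⊕ r →
        ∀ n → fromℕ 2 ⊗ γ ^ n ≡ fromℕ (lucas n) ⊕ r ⊗ fromℕ (fib n)
binet γ r γ²≡γ+1 2γ≡1+r = go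
  where
  go : ∀ n → fromℕ 2 ⊗ γ ^ n ≡ fromℕ (lucas n) ⊕ r ⊗ fromℕ (fib n)
  go zero          = initial r
    where
    initial : ∀ r → fromℕ 2 ⊗ 1Q5 ≡ fromℕ 2 ⊕ r ⊗ fromℕ 0
    initial = solve-∀ Q5-ring
  go (suc zero)    = trans (cong (fromℕ 2 ⊗_) (⊗-identityʳ γ)) (trans 2γ≡1+r (initial r))
    where
    initial : ∀ r → 1Q5 ⊕ r ≡ fromℕ 1 ⊕ r ⊗ fromℕ 1
    initial = solve-∀ Q5-ring
  go (suc (suc n)) = begin
    fromℕ 2 ⊗ (γ ⊗ (γ ⊗ γ ^ n))
      ≡⟨ cong (fromℕ 2 ⊗_) (trans (sym (⊗-assoc γ γ (γ ^ n))) (cong (_⊗ γ ^ n) γ²≡γ+1)) ⟩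
    fromℕ 2 ⊗ ((γ ⊕ 1Q5) ⊗ γ ^ n)
      ≡⟨ distrib γ (γ ^ n) ⟩
    fromℕ 2 ⊗ γ ^ suc n ⊕ fromℕ 2 ⊗ γ ^ n
      ≡⟨ cong₂ _⊕_ (go (suc n)) (go n) ⟩
    (L₁ ⊕ r ⊗ F₁) ⊕ (L₀ ⊕ r ⊗ F₀)
      ≡⟨ regroup L₁ L₀ r F₁ F₀ ⟩
    (L₁ ⊕ L₀) ⊕ r ⊗ (F₁ ⊕ F₀)
      ≡⟨ cong₂ (λ a b → a ⊕ r ⊗ b) (fromℕ-+ (lucas (suc n)) (lucas n)) (fromℕ-+ (fib (suc n)) (fib n)) ⟨
    fromℕ (lucas (suc (suc n))) ⊕ r ⊗ fromℕ (fib (suc (suc n))) ∎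
    where
    L₁ = fromℕ (lucas (suc n))
    L₀ = fromℕ (lucas n)
    F₁ = fromℕ (fib (suc n))
    F₀ = fromℕ (fib n)
    distrib : ∀ g p → fromℕ 2 ⊗ ((g ⊕ 1Q5) ⊗ p) ≡ fromℕ 2 ⊗ (g ⊗ p) ⊕ fromℕ 2 ⊗ p
    distrib = solve-∀ Q5-ring
    regroup : ∀ a b r c d → (a ⊕ r ⊗ c) ⊕ (b ⊕ r ⊗ d) ≡ (a ⊕ b) ⊕ r ⊗ (c ⊕ d)
    regroup = solve-∀ Q5-ring

binet-α : ∀ n → fromℕ 2 ⊗ α ^ n ≡ fromℕ (lucas n) ⊕ √5 ⊗ fromℕ (fib n)
binet-α = binet α √5 refl refl

binet-β : ∀ n → fromℕ 2 ⊗ β ^ n ≡ fromℕ (lucas n) ⊕ ⊖ √5 ⊗ fromℕ (fib n)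
binet-β = binet β (⊖ √5) refl refl

√5-fib : ∀ n → √5 ⊗ fromℕ (fib n) ≡ α ^ n ⊝ β ^ n
√5-fib n = begin
  √5 ⊗ F
    ≡⟨ halve L F ⟩
  fromℚ ½ ⊗ ((L ⊕ √5 ⊗ F) ⊝ (L ⊕ ⊖ √5 ⊗ F))
    ≡⟨ cong₂ (λ a b → fromℚ ½ ⊗ (a ⊝ b)) (binet-α n) (binet-β n) ⟨
  fromℚ ½ ⊗ (fromℕ 2 ⊗ α ^ n ⊝ fromℕ 2 ⊗ β ^ n)
    ≡⟨ unhalve (α ^ n) (β ^ n) ⟩
  α ^ n ⊝ β ^ n ∎
  where
  L = fromℕ (lucas n)
  F = fromℕ (fib n)
  halve : ∀ L F → √5 ⊗ F ≡ fromℚ ½ ⊗ ((L ⊕ √5 ⊗ F) ⊝ (L ⊕ ⊖ √5 ⊗ F))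
  halve = solve-∀ Q5-ring
  unhalve : ∀ a b → fromℚ ½ ⊗ (fromℕ 2 ⊗ a ⊝ fromℕ 2 ⊗ b) ≡ a ⊝ b
  unhalve = solve-∀ Q5-ring

√5fib : ℕ → Q5
√5fib j = √5 ⊗ fromℕ (fib j)

2α^j≡2β^j+2√5fib : ∀ j → fromℕ 2 ⊗ α ^ j ≡ fromℕ 2 ⊗ β ^ j ⊕ √5fib j ⊕ √5fib j
2α^j≡2β^j+2√5fib j = trans (double (α ^ j) (β ^ j)) (cong (λ d → fromℕ 2 ⊗ β ^ j ⊕ d ⊕ d) (sym (√5-fib j)))
  where
  double : ∀ a b → fromℕ 2 ⊗ a ≡ fromℕ 2 ⊗ b ⊕ (a ⊝ b) ⊕ (a ⊝ b)
  double = solve-∀ Q5-ring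

2[2β^j+√5fib⊗α]≡-√5fib+L[j+3] : ∀ j →
  fromℕ 2 ⊗ (fromℕ 2 ⊗ β ^ j ⊕ √5fib j ⊗ α) ≡ ⊖ √5fib j ⊕ fromℕ (lucas (j + 3))
2[2β^j+√5fib⊗α]≡-√5fib+L[j+3] j = begin
  fromℕ 2 ⊗ (fromℕ 2 ⊗ β ^ j ⊕ √5 ⊗ F ⊗ α)
    ≡⟨ cong (λ e → fromℕ 2 ⊗ (e ⊕ √5 ⊗ F ⊗ α)) (binet-β j) ⟩
  fromℕ 2 ⊗ ((L ⊕ ⊖ √5 ⊗ F) ⊕ √5 ⊗ F ⊗ α)
    ≡⟨ expand L F ⟩
  ⊖ (√5 ⊗ F) ⊕ (fromℕ 5 ⊗ F ⊕ fromℕ 2 ⊗ L)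
    ≡⟨ cong (⊖ (√5 ⊗ F) ⊕_) (cong₂ _⊕_ (fromℕ-* 5 (fib j)) (fromℕ-* 2 (lucas j))) ⟨
  ⊖ (√5 ⊗ F) ⊕ (fromℕ (5 * fib j) ⊕ fromℕ (2 * lucas j))
    ≡⟨ cong (⊖ (√5 ⊗ F) ⊕_) (trans (sym (fromℕ-+ (5 * fib j) (2 * lucas j))) (cong fromℕ (sym (lucas[n+3] j)))) ⟩
  ⊖ (√5 ⊗ F) ⊕ fromℕ (lucas (j + 3)) ∎
  where
  L = fromℕ (lucas j)
  F = fromℕ (fib j)
  expand : ∀ L F → fromℕ 2 ⊗ ((L ⊕ ⊖ √5 ⊗ F) ⊕ √5 ⊗ F ⊗ α) ≡ ⊖ (√5 ⊗ F) ⊕ (fromℕ 5 ⊗ F ⊕ fromℕ 2 ⊗ L)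
  expand = solve-∀ Q5-ring

2[2α^j-√5fib⊗α]≡√5fib-L[j-3] : ∀ i → let j = 3 + i in
  fromℕ 2 ⊗ (fromℕ 2 ⊗ α ^ j ⊕ ⊖ √5fib j ⊗ α) ≡ √5fib j ⊕ ⊖ fromℕ (lucas i)
2[2α^j-√5fib⊗α]≡√5fib-L[j-3] i = begin
  fromℕ 2 ⊗ (fromℕ 2 ⊗ α ^ j ⊕ ⊖ (√5 ⊗ F) ⊗ α)
    ≡⟨ cong (λ e → fromℕ 2 ⊗ (e ⊕ ⊖ (√5 ⊗ F) ⊗ α)) (binet-α j) ⟩
  fromℕ 2 ⊗ ((L ⊕ √5 ⊗ F) ⊕ ⊖ (√5 ⊗ F) ⊗ α)
    ≡⟨ expand L F (fromℕ (lucas i)) ⟩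
  √5 ⊗ F ⊕ ⊖ fromℕ (lucas i) ⊕ (fromℕ (lucas i) ⊕ fromℕ 2 ⊗ L ⊝ fromℕ 5 ⊗ F)
    ≡⟨ cong (λ e → √5 ⊗ F ⊕ ⊖ fromℕ (lucas i) ⊕ (e ⊝ fromℕ 5 ⊗ F)) lucas-sum ⟩
  √5 ⊗ F ⊕ ⊖ fromℕ (lucas i) ⊕ (fromℕ 5 ⊗ F ⊝ fromℕ 5 ⊗ F)
    ≡⟨ trans (cong (√5 ⊗ F ⊕ ⊖ fromℕ (lucas i) ⊕_) (⊖-inverseʳ (fromℕ 5 ⊗ F))) (⊕-identityʳ _) ⟩
  √5 ⊗ F ⊕ ⊖ fromℕ (lucas i) ∎
  where
  j = 3 + i
  L = fromℕ (lucas j)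
  F = fromℕ (fib j)
  expand : ∀ L F l → fromℕ 2 ⊗ ((L ⊕ √5 ⊗ F) ⊕ ⊖ (√5 ⊗ F) ⊗ α)
    ≡ √5 ⊗ F ⊕ ⊖ l ⊕ (l ⊕ fromℕ 2 ⊗ L ⊝ fromℕ 5 ⊗ F)
  expand = solve-∀ Q5-ring
  lucas-sum : fromℕ (lucas i) ⊕ fromℕ 2 ⊗ L ≡ fromℕ 5 ⊗ F
  lucas-sum = begin
    fromℕ (lucas i) ⊕ fromℕ 2 ⊗ L        ≡⟨ cong (fromℕ (lucas i) ⊕_) (fromℕ-* 2 (lucas j)) ⟨
    fromℕ (lucas i) ⊕ fromℕ (2 * lucas j) ≡⟨ fromℕ-+ (lucas i) (2 * lucas j) ⟨
    fromℕ (lucas i + 2 * lucas j)         ≡⟨ cong fromℕ (5*fib[3+n] i) ⟨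
    fromℕ (5 * fib j)                     ≡⟨ fromℕ-* 5 (fib j) ⟩
    fromℕ 5 ⊗ F                           ∎

-- The two identities

⊗-cancelˡ-√5 : ∀ {x y} → √5 ⊗ x ≡ √5 ⊗ y → x ≡ y
⊗-cancelˡ-√5 {x} {y} √5x≡√5y =
  trans (sym (inverse x)) (trans (cong (q5 0ℚ (+ 1 ℚ./ 5) ⊗_) √5x≡√5y) (inverse y))
  where
  inverse : ∀ x → q5 0ℚ (+ 1 ℚ./ 5) ⊗ (√5 ⊗ x) ≡ x
  inverse = solve-∀ Q5-ring

lhs-zero : ∀ j σ → lhs 0 j σ ≡ 0Q5
lhs-zero j σ rewrite ℕ.*-zeroʳ j = refl

√5-lhs : ∀ n j σ → √5 ⊗ lhs n j σ
  ≡ homBernoulli n σ (fromℕ 2 ⊗ α ^ j ⊕ σ ⊗ α) ⊝ homBernoulli n σ (fromℕ 2 ⊗ β ^ j ⊕ σ ⊗ α)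
√5-lhs n j σ = begin
  √5 ⊗ lhs n j σ
    ≡⟨ ⊗-distribˡ-Σ5 (suc n) √5 term ⟩
  Σ5 (suc n) (λ k → √5 ⊗ term k)
    ≡⟨ Σ5-cong (suc n) √5-term ⟩
  Σ5 (suc n) (λ k → summand (fromℕ 2 ⊗ α ^ j) k ⊝ summand (fromℕ 2 ⊗ β ^ j) k)
    ≡⟨ Σ5-⊝ (suc n) (summand (fromℕ 2 ⊗ α ^ j)) (summand (fromℕ 2 ⊗ β ^ j)) ⟩
  Σ5 (suc n) (summand (fromℕ 2 ⊗ α ^ j)) ⊝ Σ5 (suc n) (summand (fromℕ 2 ⊗ β ^ j))
    ≡⟨ cong₂ _⊝_ (homBernoulli-translate n (fromℕ 2 ⊗ α ^ j) σ α)
                 (homBernoulli-translate n (fromℕ 2 ⊗ β ^ j) σ α) ⟩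
  homBernoulli n σ (fromℕ 2 ⊗ α ^ j ⊕ σ ⊗ α) ⊝ homBernoulli n σ (fromℕ 2 ⊗ β ^ j ⊕ σ ⊗ α) ∎
  where
  P : ℕ → Q5
  P k = σ ^ (n ∸ k) ⊗ bernoulliPoly (n ∸ k) α
  term : ℕ → Q5
  term k = fromℕ ((n C k) * (2 ℕ.^ k) * fib (j * k)) ⊗ σ ^ (n ∸ k) ⊗ bernoulliPoly (n ∸ k) α
  summand : Q5 → ℕ → Q5
  summand a k = choose n k ⊗ a ^ k ⊗ P k
  coefficient : ∀ k → fromℕ ((n C k) * (2 ℕ.^ k) * fib (j * k)) ≡ choose n k ⊗ fromℕ 2 ^ k ⊗ fromℕ (fib (j * k))
  coefficient k = trans (fromℕ-* ((n C k) * (2 ℕ.^ k)) (fib (j * k)))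
    (cong (_⊗ fromℕ (fib (j * k))) (trans (fromℕ-* (n C k) (2 ℕ.^ k)) (cong (choose n k ⊗_) (fromℕ-^ 2 k))))
  regroup : ∀ r c t f p b → r ⊗ (c ⊗ t ⊗ f ⊗ p ⊗ b) ≡ c ⊗ t ⊗ (r ⊗ f) ⊗ (p ⊗ b)
  regroup = solve-∀ Q5-ring
  split : ∀ c t a b p → c ⊗ t ⊗ (a ⊝ b) ⊗ p ≡ c ⊗ (t ⊗ a) ⊗ p ⊝ c ⊗ (t ⊗ b) ⊗ p
  split = solve-∀ Q5-ring
  √5-term : ∀ k → √5 ⊗ term k ≡ summand (fromℕ 2 ⊗ α ^ j) k ⊝ summand (fromℕ 2 ⊗ β ^ j) k
  √5-term k = begin
    √5 ⊗ term k
      ≡⟨ cong (λ c → √5 ⊗ (c ⊗ σ ^ (n ∸ k) ⊗ bernoulliPoly (n ∸ k) α)) (coefficient k) ⟩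
    √5 ⊗ (choose n k ⊗ fromℕ 2 ^ k ⊗ fromℕ (fib (j * k)) ⊗ σ ^ (n ∸ k) ⊗ bernoulliPoly (n ∸ k) α)
      ≡⟨ regroup √5 (choose n k) (fromℕ 2 ^ k) (fromℕ (fib (j * k))) (σ ^ (n ∸ k)) (bernoulliPoly (n ∸ k) α) ⟩
    choose n k ⊗ fromℕ 2 ^ k ⊗ √5fib (j * k) ⊗ P k
      ≡⟨ cong (λ e → choose n k ⊗ fromℕ 2 ^ k ⊗ e ⊗ P k)
              (trans (√5-fib (j * k)) (cong₂ _⊝_ (^-*-assoc α j k) (^-*-assoc β j k))) ⟩
    choose n k ⊗ fromℕ 2 ^ k ⊗ ((α ^ j) ^ k ⊝ (β ^ j) ^ k) ⊗ P k
      ≡⟨ split (choose n k) (fromℕ 2 ^ k) ((α ^ j) ^ k) ((β ^ j) ^ k) (P k) ⟩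
    choose n k ⊗ (fromℕ 2 ^ k ⊗ (α ^ j) ^ k) ⊗ P k ⊝ choose n k ⊗ (fromℕ 2 ^ k ⊗ (β ^ j) ^ k) ⊗ P k
      ≡⟨ cong₂ (λ a b → choose n k ⊗ a ⊗ P k ⊝ choose n k ⊗ b ⊗ P k)
               (^-distrib-⊗ (fromℕ 2) (α ^ j) k) (^-distrib-⊗ (fromℕ 2) (β ^ j) k) ⟨
    summand (fromℕ 2 ⊗ α ^ j) k ⊝ summand (fromℕ 2 ⊗ β ^ j) k ∎

√5-rhs : ∀ m j {c z₁ z₂} → fromℕ 2 ⊗ z₁ ≡ √5fib j ⊕ c → fromℕ 2 ⊗ z₂ ≡ ⊖ √5fib j ⊕ c →
  √5 ⊗ rhs (suc m) j (√5fib j) c ≡ fromℕ (suc m) ⊗ √5fib j ⊗ (z₁ ^ m ⊕ z₂ ^ m)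
√5-rhs m j {c} {z₁} {z₂} 2z₁≡s+c 2z₂≡-s+c = begin
  √5 ⊗ (fromℚ (ℕtoℚ (suc m * fib j) ℚ.* powQ ½ m) ⊗ ((s ⊕ c) ^ m ⊕ (⊖ s ⊕ c) ^ m))
    ≡⟨ cong₂ (λ a b → √5 ⊗ (a ⊗ b)) coefficient powers ⟩
  √5 ⊗ ((N ⊗ F ⊗ fromℚ ½ ^ m) ⊗ (fromℕ 2 ^ m ⊗ z₁ ^ m ⊕ fromℕ 2 ^ m ⊗ z₂ ^ m))
    ≡⟨ regroup √5 N F (fromℚ ½ ^ m) (fromℕ 2 ^ m) (z₁ ^ m) (z₂ ^ m) ⟩
  N ⊗ s ⊗ (z₁ ^ m ⊕ z₂ ^ m) ⊗ (fromℚ ½ ^ m ⊗ fromℕ 2 ^ m)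
    ≡⟨ cong (N ⊗ s ⊗ (z₁ ^ m ⊕ z₂ ^ m) ⊗_) (trans (sym (^-distrib-⊗ (fromℚ ½) (fromℕ 2) m)) (1^n≡1 m)) ⟩
  N ⊗ s ⊗ (z₁ ^ m ⊕ z₂ ^ m) ⊗ 1Q5
    ≡⟨ ⊗-identityʳ (N ⊗ s ⊗ (z₁ ^ m ⊕ z₂ ^ m)) ⟩
  N ⊗ s ⊗ (z₁ ^ m ⊕ z₂ ^ m) ∎
  where
  s = √5fib j
  N = fromℕ (suc m)
  F = fromℕ (fib j)
  coefficient : fromℚ (ℕtoℚ (suc m * fib j) ℚ.* powQ ½ m) ≡ N ⊗ F ⊗ fromℚ ½ ^ m
  coefficient = trans (fromℚ-* (ℕtoℚ (suc m * fib j)) (powQ ½ m))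
                      (cong₂ _⊗_ (fromℕ-* (suc m) (fib j)) (fromℚ-powQ ½ m))
  powers : (s ⊕ c) ^ m ⊕ (⊖ s ⊕ c) ^ m ≡ fromℕ 2 ^ m ⊗ z₁ ^ m ⊕ fromℕ 2 ^ m ⊗ z₂ ^ m
  powers = cong₂ _⊕_ (trans (cong (_^ m) (sym 2z₁≡s+c)) (^-distrib-⊗ (fromℕ 2) z₁ m))
                     (trans (cong (_^ m) (sym 2z₂≡-s+c)) (^-distrib-⊗ (fromℕ 2) z₂ m))
  regroup : ∀ r N F h t p q → r ⊗ ((N ⊗ F ⊗ h) ⊗ (t ⊗ p ⊕ t ⊗ q)) ≡ N ⊗ (r ⊗ F) ⊗ (p ⊕ q) ⊗ (h ⊗ t)
  regroup = solve-∀ Q5-ring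

corollary19-plus : ∀ n j → lhs n j (√5fib j) ≡ rhs n j (√5fib j) (fromℕ (lucas (j + 3)))
corollary19-plus zero    j = lhs-zero j (√5fib j)
corollary19-plus (suc m) j = ⊗-cancelˡ-√5 (begin
  √5 ⊗ lhs (suc m) j s
    ≡⟨ √5-lhs (suc m) j s ⟩
  H (fromℕ 2 ⊗ α ^ j ⊕ s ⊗ α) ⊝ H z
    ≡⟨ cong (λ w → H w ⊝ H z) shift ⟩
  H (z ⊕ s ⊕ s) ⊝ H z
    ≡⟨ homBernoulli-difference₂ m s z ⟩
  fromℕ (suc m) ⊗ s ⊗ ((z ⊕ s) ^ m ⊕ z ^ m)
    ≡⟨ √5-rhs m j 2[z+s]≡s+c 2z≡-s+c ⟨
  √5 ⊗ rhs (suc m) j s c ∎)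
  where
  s = √5fib j
  c = fromℕ (lucas (j + 3))
  H = homBernoulli (suc m) s
  z = fromℕ 2 ⊗ β ^ j ⊕ s ⊗ α
  shift : fromℕ 2 ⊗ α ^ j ⊕ s ⊗ α ≡ z ⊕ s ⊕ s
  shift = trans (cong (_⊕ s ⊗ α) (2α^j≡2β^j+2√5fib j)) (regroup (fromℕ 2 ⊗ β ^ j) s (s ⊗ α))
    where
    regroup : ∀ b s y → b ⊕ s ⊕ s ⊕ y ≡ b ⊕ y ⊕ s ⊕ s
    regroup = solve-∀ Q5-ring
  2z≡-s+c : fromℕ 2 ⊗ z ≡ ⊖ s ⊕ c
  2z≡-s+c = 2[2β^j+√5fib⊗α]≡-√5fib+L[j+3] j
  2[z+s]≡s+c : fromℕ 2 ⊗ (z ⊕ s) ≡ s ⊕ c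
  2[z+s]≡s+c = trans (⊗-distribˡ-⊕ (fromℕ 2) z s) (trans (cong (_⊕ fromℕ 2 ⊗ s) 2z≡-s+c) (regroup s c))
    where
    regroup : ∀ s c → (⊖ s ⊕ c) ⊕ fromℕ 2 ⊗ s ≡ s ⊕ c
    regroup = solve-∀ Q5-ring

corollary19-minus : ∀ n j → j ≥ 3 →
  lhs n j (⊖ √5fib j) ≡ rhs n j (√5fib j) (⊖ fromℕ (lucas (j ∸ 3)))
corollary19-minus zero    j                   _ = lhs-zero j (⊖ √5fib j)
corollary19-minus (suc m) 0                   ()
corollary19-minus (suc m) 1                   (s≤s ())
corollary19-minus (suc m) 2                   (s≤s (s≤s ()))
corollary19-minus (suc m) j@(suc (suc (suc i))) _ = ⊗-cancelˡ-√5 (begin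
  √5 ⊗ lhs (suc m) j σ
    ≡⟨ √5-lhs (suc m) j σ ⟩
  H w ⊝ H (fromℕ 2 ⊗ β ^ j ⊕ σ ⊗ α)
    ≡⟨ cong (λ v → H w ⊝ H v) shift ⟩
  H w ⊝ H (w ⊕ σ ⊕ σ)
    ≡⟨ antisym (H w) (H (w ⊕ σ ⊕ σ)) ⟩
  ⊖ (H (w ⊕ σ ⊕ σ) ⊝ H w)
    ≡⟨ cong ⊖_ (homBernoulli-difference₂ m σ w) ⟩
  ⊖ (fromℕ (suc m) ⊗ σ ⊗ ((w ⊕ σ) ^ m ⊕ w ^ m))
    ≡⟨ unnegate (fromℕ (suc m)) s (w ^ m) ((w ⊕ σ) ^ m) ⟩
  fromℕ (suc m) ⊗ s ⊗ (w ^ m ⊕ (w ⊕ σ) ^ m)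
    ≡⟨ √5-rhs m j 2w≡s+c 2[w+σ]≡-s+c ⟨
  √5 ⊗ rhs (suc m) j s c ∎)
  where
  s = √5fib j
  σ = ⊖ s
  c = ⊖ fromℕ (lucas i)
  H = homBernoulli (suc m) σ
  w = fromℕ 2 ⊗ α ^ j ⊕ σ ⊗ α
  antisym : ∀ a b → a ⊝ b ≡ ⊖ (b ⊝ a)
  antisym = solve-∀ Q5-ring
  unnegate : ∀ N s p q → ⊖ (N ⊗ ⊖ s ⊗ (q ⊕ p)) ≡ N ⊗ s ⊗ (p ⊕ q)
  unnegate = solve-∀ Q5-ring
  shift : fromℕ 2 ⊗ β ^ j ⊕ σ ⊗ α ≡ w ⊕ σ ⊕ σ
  shift = trans (regroup (fromℕ 2 ⊗ β ^ j) s (σ ⊗ α)) (cong (λ a → a ⊕ σ ⊗ α ⊕ σ ⊕ σ) (sym (2α^j≡2β^j+2√5fib j)))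
    where
    regroup : ∀ b s y → b ⊕ y ≡ b ⊕ s ⊕ s ⊕ y ⊕ ⊖ s ⊕ ⊖ s
    regroup = solve-∀ Q5-ring
  2w≡s+c : fromℕ 2 ⊗ w ≡ s ⊕ c
  2w≡s+c = 2[2α^j-√5fib⊗α]≡√5fib-L[j-3] i
  2[w+σ]≡-s+c : fromℕ 2 ⊗ (w ⊕ σ) ≡ ⊖ s ⊕ c
  2[w+σ]≡-s+c = trans (⊗-distribˡ-⊕ (fromℕ 2) w σ) (trans (cong (_⊕ fromℕ 2 ⊗ σ) 2w≡s+c) (regroup s c))
    where
    regroup : ∀ s c → (s ⊕ c) ⊕ fromℕ 2 ⊗ ⊖ s ≡ ⊖ s ⊕ c
    regroup = solve-∀ Q5-ring

corollary19 :
    ((n j : ℕ) → j ≥ 1 →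
      lhs n j (√5 ⊗ fromℕ (fib j))
        ≡ rhs n j (√5 ⊗ fromℕ (fib j)) (fromℕ (lucas (j + 3))))
    ×
    ((n j : ℕ) → j ≥ 3 →
      lhs n j (⊖ (√5 ⊗ fromℕ (fib j)))
        ≡ rhs n j (√5 ⊗ fromℕ (fib j)) (⊖ fromℕ (lucas (j ∸ 3))))
-- The first identity holds for every j.
corollary19 = (λ n j _ → corollary19-plus n j) , corollary19-minus
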